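{- Let $m\ge1$ and $n\ge 2(m+1)$ be integers. Then $\gamma_{gr}(C_n^m)=n-2m$.
   Context: $C_n^m$ is the $m$-th power of the cycle $C_n$ (two vertices adjacent iff their distance in $C_n$ is at most $m$). For a sequence $S=(v_1,\dots,v_k)$ of distinct vertices, $PN_S(v_i)=N[v_i]\setminus\bigcup_{j<i}N[v_j]$; $S$ is legal dominating if $\{v_1,\dots,v_k\}$ dominates the graph and each $PN_S(v_i)\ne\emptyset$; $\gamma_{gr}$ is the maximum length of such a sequence. -}

module Defs where

open import Data.Nat using (ℕ; _≤_; _∸_; _⊓_; ∣_-_∣)
open import Data.Fin using (Fin; toℕ)
open import Data.List using (List; []; _∷_; length)
open import Data.List.Relation.Unary.Any using (Any)
open import Data.List.Relation.Unary.Unique.Propositional using (Unique)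
open import Data.Product using (Σ; _×_)
open import Data.Sum using (_⊎_)
open import Data.Unit using (⊤)
open import Relation.Nullary using (¬_)
open import Relation.Binary.PropositionalEquality using (_≡_)

Graph : ℕ → Set₁
Graph n = Fin n → Fin n → Set

cycDist : {n : ℕ} → Fin n → Fin n → ℕ
cycDist {n} i j = ∣ toℕ i - toℕ j ∣ ⊓ (n ∸ ∣ toℕ i - toℕ j ∣)

CyclePower : (n m : ℕ) → Graph n
CyclePower n m i j = ¬ (i ≡ j) × cycDist i j ≤ m

module _ {n : ℕ} (G : Graph n) where

  InN : Fin n → Fin n → Set
  InN v u = u ≡ v ⊎ G v u

  Footprinting : List (Fin n) → List (Fin n) → Set
  Footprinting prev [] = ⊤
  Footprinting prev (v ∷ S) =
    Σ (Fin n) (λ u → InN v u × ¬ Any (λ w → InN w u) prev)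
    × Footprinting (v ∷ prev) S

  Dominates : List (Fin n) → Set
  Dominates S = (u : Fin n) → Any (λ v → InN v u) S

  LegalDominating : List (Fin n) → Set
  LegalDominating S = Unique S × Dominates S × Footprinting [] S

  GrundyDominationNumber : ℕ → Set
  GrundyDominationNumber k =
    Σ (List (Fin n)) (λ S → LegalDominating S × length S ≡ k)
    × ((S : List (Fin n)) → LegalDominating S → length S ≤ k)

-- After the first vertex v of a legal sequence, every later vertex has a
-- private neighbour outside N[v], and these are distinct.  Measured clockwise
-- from v, the vertices outside N[v] lie at offsets m + 1, …, n - m - 1, so there
-- are only n - 2m - 1 of them.  Conversely 0, 1, …, n - 2m - 1 is a legal
-- dominating sequence: vertex i has the private neighbour i + m, vertices u below
-- n - m are dominated by u - m, and the remaining ones by 0 across the wrap-around.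
module Submission where

open import Defs
open import Data.Nat
open import Data.Nat.Properties
open import Data.Fin as Fin using (Fin; toℕ; fromℕ<; inject≤)
open import Data.Fin.Properties using (toℕ<n; toℕ-fromℕ<; toℕ-inject≤; toℕ-injective; inject≤-injective)
open import Data.List using (List; []; _∷_; length; tabulate)
open import Data.List.Properties using (length-map; length-tabulate; length-removeAt′)
open import Data.List.Membership.Propositional using (_∈_)
open import Data.List.Membership.DecPropositional _≟_ using (_∈?_)
open import Data.List.Relation.Unary.All as All using (All; []; _∷_)
import Data.List.Relation.Unary.All.Properties as All
open import Data.List.Relation.Unary.Any as Any using (Any; here; there; _─_)
import Data.List.Relation.Unary.Any.Properties as Any
open import Data.List.Relation.Unary.AllPairs using ([]; _∷_)
open import Data.List.Relation.Unary.Unique.Propositional using (Unique)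
import Data.List.Relation.Unary.Unique.Propositional.Properties as Unique
open import Data.Product using (Σ; _×_; _,_; proj₁)
open import Data.Sum using (_⊎_; inj₁; inj₂; [_,_])
open import Data.Unit using (tt)
open import Function using (_∘_)
open import Relation.Nullary using (¬_; yes; no; contradiction)
open import Relation.Binary.PropositionalEquality hiding ([_])

module _ {a} {A : Set a} where

  Unique-─ : ∀ {x : A} {xs} → Unique xs → (p : x ∈ xs) → Unique (xs ─ p)
  Unique-─ (_ ∷ xs!) (here _) = xs!
  Unique-─ (x∉xs ∷ xs!) (there p) = All.─⁺ p x∉xs ∷ Unique-─ xs! p

  Unique-─-∉ : ∀ {x : A} {xs} → Unique xs → (p : x ∈ xs) → All (x ≢_) (xs ─ p)
  Unique-─-∉ (y∉ys ∷ _) (here refl) = y∉ys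
  Unique-─-∉ (y∉ys ∷ ys!) (there p) = (λ x≡y → All.lookup y∉ys p (sym x≡y)) ∷ Unique-─-∉ ys! p

Between : ℕ → ℕ → ℕ → Set
Between a b x = a ≤ x × x < b

Between-narrow : ∀ {a b x} → Between a (suc b) x × b ≢ x → Between a b x
Between-narrow ((a≤x , x≤b) , b≢x) = a≤x , ≤∧≢⇒< (s≤s⁻¹ x≤b) (b≢x ∘ sym)

Unique-Between⇒length≤∸ : ∀ {a} b {xs} → Unique xs → All (Between a b) xs → length xs ≤ b ∸ a
Unique-Between⇒length≤∸ zero {[]} _ _ = z≤n
Unique-Between⇒length≤∸ zero {_ ∷ _} _ ((_ , ()) ∷ _)
Unique-Between⇒length≤∸ {a} (suc b) {xs} xs! xs∈[a,b] with b ∈? xs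
... | no b∉xs = begin
  length xs ≤⟨ Unique-Between⇒length≤∸ b xs! (All.zipWith Between-narrow (xs∈[a,b] , All.¬Any⇒All¬ xs b∉xs)) ⟩
  b ∸ a     ≤⟨ ∸-monoˡ-≤ a (n≤1+n b) ⟩
  suc b ∸ a ∎
  where open ≤-Reasoning
... | yes b∈xs = begin
  length xs                 ≡⟨ length-removeAt′ xs (Any.index b∈xs) ⟩
  suc (length (xs ─ b∈xs))  ≤⟨ s≤s (Unique-Between⇒length≤∸ b (Unique-─ xs! b∈xs) rest∈[a,b]) ⟩
  suc (b ∸ a)               ≡⟨ +-∸-assoc 1 (proj₁ (All.lookup xs∈[a,b] b∈xs)) ⟨
  suc b ∸ a                 ∎
  where open ≤-Reasoning
        rest∈[a,b] : All (Between a b) (xs ─ b∈xs)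
        rest∈[a,b] = All.zipWith Between-narrow (All.─⁺ b∈xs xs∈[a,b] , Unique-─-∉ xs! b∈xs)

module _ {n : ℕ} (G : Graph n) where

  Undominated : List (Fin n) → Fin n → Set
  Undominated prev u = ¬ Any (λ w → InN G w u) prev

  privateNeighbours : ∀ prev S → Footprinting G prev S →
    Σ (List (Fin n)) λ us → Unique us × All (Undominated prev) us × length us ≡ length S
  privateNeighbours prev [] tt = [] , [] , [] , refl
  privateNeighbours prev (v ∷ S) ((u , v∼u , u-new) , rest)
    with us , us! , us-new , len ← privateNeighbours (v ∷ prev) S rest =
    u ∷ us , All.map (λ u′-new u≡u′ → u′-new (here (subst (InN G v) u≡u′ v∼u))) us-new ∷ us!
           , u-new ∷ All.map (_∘ there) us-new
           , cong suc len

  length≤1+nonNeighbours : ∀ {k v S} →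
    (∀ {us} → Unique us → All (λ u → ¬ InN G v u) us → length us ≤ k) →
    Footprinting G [] (v ∷ S) → length (v ∷ S) ≤ suc k
  length≤1+nonNeighbours {v = v} {S} bound (_ , rest)
    with us , us! , us-new , len ← privateNeighbours (v ∷ []) S rest =
    s≤s (subst (_≤ _) len (bound us! (All.map (_∘ here) us-new)))

  tabulate-footprinting : ∀ {k} (S : Fin k → Fin n) (w : Fin k → Fin n) prev →
    (∀ i → InN G (S i) (w i)) →
    (∀ {i j} → j Fin.< i → ¬ InN G (S j) (w i)) →
    (∀ i → Undominated prev (w i)) →
    Footprinting G prev (tabulate S)
  tabulate-footprinting {zero} S w prev S∼w earlier≁w new = tt
  tabulate-footprinting {suc k} S w prev S∼w earlier≁w new =
    (w Fin.zero , S∼w Fin.zero , new Fin.zero) ,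
    tabulate-footprinting (S ∘ Fin.suc) (w ∘ Fin.suc) (S Fin.zero ∷ prev)
      (S∼w ∘ Fin.suc) (λ j<i → earlier≁w (s<s j<i)) new′
    where
    new′ : ∀ i → Undominated (S Fin.zero ∷ prev) (w (Fin.suc i))
    new′ i (here S₀∼w) = earlier≁w z<s S₀∼w
    new′ i (there dom) = new (Fin.suc i) dom

m<n∸o⇒o<n∸m : ∀ {m n o} → m < n ∸ o → o < n ∸ m
m<n∸o⇒o<n∸m {m} {n} {o} m<n∸o =
  m+n≤o⇒m≤o∸n (suc o) (subst (λ k → suc k ≤ n) (+-comm m o) (m≤o∸n⇒m+n≤o (suc m) o≤n m<n∸o))
  where o≤n = <⇒≤ (m∸n≢0⇒n<m (m<n⇒n≢0 m<n∸o))

module _ {n : ℕ} where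

  cycDist-self : (v : Fin n) → cycDist v v ≡ 0
  cycDist-self v rewrite ∣n-n∣≡0 (toℕ v) = refl

  cycDist-≤ : {v u : Fin n} → toℕ v ≤ toℕ u →
    cycDist v u ≡ (toℕ u ∸ toℕ v) ⊓ (n ∸ (toℕ u ∸ toℕ v))
  cycDist-≤ v≤u rewrite m≤n⇒∣m-n∣≡n∸m v≤u = refl

  offset : Fin n → Fin n → ℕ
  offset v u with toℕ v ≤? toℕ u
  ... | yes _ = toℕ u ∸ toℕ v
  ... | no _ = n ∸ (toℕ v ∸ toℕ u)

  cycDist≡offset⊓ : (v u : Fin n) → cycDist v u ≡ offset v u ⊓ (n ∸ offset v u)
  cycDist≡offset⊓ v u with toℕ v ≤? toℕ u
  ... | yes v≤u = cycDist-≤ v≤u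
  ... | no v≰u rewrite m≤n⇒∣n-m∣≡n∸m (<⇒≤ (≰⇒> v≰u))
                     | m∸[m∸n]≡n (≤-trans (m∸n≤m (toℕ v) (toℕ u)) (<⇒≤ (toℕ<n v))) =
    ⊓-comm _ _

  forward<wrapped : ∀ {v u u′ : Fin n} → toℕ v ≤ toℕ u → toℕ u ∸ toℕ v < n ∸ (toℕ v ∸ toℕ u′)
  forward<wrapped {v} {u} {u′} v≤u =
    ≤-trans (∸-monoˡ-< (toℕ<n u) v≤u) (∸-monoʳ-≤ n (m∸n≤m (toℕ v) (toℕ u′)))

  offset-injective : ∀ {v u u′ : Fin n} → offset v u ≡ offset v u′ → u ≡ u′
  offset-injective {v} {u} {u′} eq with toℕ v ≤? toℕ u | toℕ v ≤? toℕ u′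
  ... | yes v≤u | yes v≤u′ = toℕ-injective (∸-cancelʳ-≡ v≤u v≤u′ eq)
  ... | no v≰u  | no v≰u′  = toℕ-injective (∸-cancelˡ-≡ (<⇒≤ (≰⇒> v≰u)) (<⇒≤ (≰⇒> v≰u′))
                               (∸-cancelˡ-≡ (v∸≤n u) (v∸≤n u′) eq))
    where v∸≤n : ∀ x → toℕ v ∸ toℕ x ≤ n
          v∸≤n x = ≤-trans (m∸n≤m (toℕ v) (toℕ x)) (<⇒≤ (toℕ<n v))
  ... | yes v≤u | no v≰u′  = contradiction eq (<⇒≢ (forward<wrapped {u′ = u′} v≤u))
  ... | no v≰u  | yes v≤u′ = contradiction (sym eq) (<⇒≢ (forward<wrapped {u′ = u} v≤u′))

module _ {n m : ℕ} where

  near⇒InN : ∀ {v u : Fin n} → cycDist v u ≤ m → InN (CyclePower n m) v u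
  near⇒InN {v} {u} near with u Fin.≟ v
  ... | yes u≡v = inj₁ u≡v
  ... | no u≢v = inj₂ ((u≢v ∘ sym) , near)

  far⇒¬InN : ∀ {v u : Fin n} → m < cycDist v u → ¬ InN (CyclePower n m) v u
  far⇒¬InN {v} far (inj₁ refl) = <⇒≱ far (subst (_≤ m) (sym (cycDist-self v)) z≤n)
  far⇒¬InN far (inj₂ (_ , near)) = <⇒≱ far near

  ¬InN⇒offset-between : ∀ {v u : Fin n} → ¬ InN (CyclePower n m) v u →
    Between (suc m) (n ∸ m) (offset v u)
  ¬InN⇒offset-between {v} {u} ¬v∼u =
    ≤-trans far (m⊓n≤m _ _) , m<n∸o⇒o<n∸m (≤-trans far (m⊓n≤n _ _))
    where
    far : m < offset v u ⊓ (n ∸ offset v u)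
    far = subst (m <_) (cycDist≡offset⊓ v u) (≰⇒> (¬v∼u ∘ near⇒InN))

  nonNeighbours-length≤ : ∀ {v : Fin n} {us} → Unique us →
    All (λ u → ¬ InN (CyclePower n m) v u) us → length us ≤ n ∸ m ∸ suc m
  nonNeighbours-length≤ {v} {us} us! far = subst (_≤ _) (length-map (offset v) us)
    (Unique-Between⇒length≤∸ (n ∸ m) (Unique.map⁺ (offset-injective {v = v}) us!)
      (All.map⁺ (All.map ¬InN⇒offset-between far)))

  legal-length≤ : m + m < n → ∀ {S} → LegalDominating (CyclePower n m) S → length S ≤ n ∸ (m + m)
  legal-length≤ _ {[]} _ = z≤n
  legal-length≤ 2m<n {v ∷ S} (_ , _ , fp) = begin
    length (v ∷ S)             ≤⟨ length≤1+nonNeighbours (CyclePower n m) nonNeighbours-length≤ fp ⟩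
    suc (n ∸ m ∸ suc m)        ≡⟨ +-∸-assoc 1 (m+n≤o⇒m≤o∸n (suc m) 2m<n) ⟨
    n ∸ m ∸ m                  ≡⟨ ∸-+-assoc n m m ⟩
    n ∸ (m + m)                ∎
    where open ≤-Reasoning

module LowerBound {n m : ℕ} (2m<n : m + m < n) where

  K : ℕ
  K = n ∸ (m + m)

  K≤n : K ≤ n
  K≤n = m∸n≤m n (m + m)

  K+2m≡n : K + (m + m) ≡ n
  K+2m≡n = m∸n+n≡m (<⇒≤ 2m<n)

  instance
    K-nonZero : NonZero K
    K-nonZero = >-nonZero (m<n⇒0<n∸m 2m<n)

  cycDist-at : ∀ {v u : Fin n} {a b} → toℕ v ≡ a → toℕ u ≡ b → a ≤ b →
    cycDist v u ≡ (b ∸ a) ⊓ (n ∸ (b ∸ a))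
  cycDist-at refl refl = cycDist-≤

  vertex : Fin K → Fin n
  vertex i = inject≤ i K≤n

  vertexAt : ∀ {a} → a < K → Fin n
  vertexAt a<K = vertex (fromℕ< a<K)

  toℕ-vertexAt : ∀ {a} (a<K : a < K) → toℕ (vertexAt a<K) ≡ a
  toℕ-vertexAt a<K = trans (toℕ-inject≤ _ K≤n) (toℕ-fromℕ< a<K)

  vertexAt-dominates : ∀ {a} (a<K : a < K) {u} → a ≤ toℕ u →
    toℕ u ∸ a ≤ m ⊎ n ∸ (toℕ u ∸ a) ≤ m → InN (CyclePower n m) (vertexAt a<K) u
  vertexAt-dominates a<K a≤u close = near⇒InN (subst (_≤ m)
    (sym (cycDist-at (toℕ-vertexAt a<K) refl a≤u))
    ([ ≤-trans (m⊓n≤m _ _) , ≤-trans (m⊓n≤n _ _) ] close))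

  i+m<n∸m : (i : Fin K) → toℕ i + m < n ∸ m
  i+m<n∸m i = m+n≤o⇒m≤o∸n (suc (toℕ i + m))
    (subst (λ k → suc k ≤ n) (sym (+-assoc (toℕ i) m m))
      (≤-trans (+-monoˡ-≤ (m + m) (toℕ<n i)) (≤-reflexive K+2m≡n)))

  footprint : Fin K → Fin n
  footprint i = fromℕ< (≤-trans (i+m<n∸m i) (m∸n≤m n m))

  vertex∼footprint : ∀ i → InN (CyclePower n m) (vertex i) (footprint i)
  vertex∼footprint i = near⇒InN (subst (_≤ m)
    (sym (cycDist-at (toℕ-inject≤ i K≤n) (toℕ-fromℕ< _) (m≤m+n _ _)))
    (≤-trans (m⊓n≤m _ _) (≤-reflexive (m+n∸m≡n (toℕ i) m))))

  earlier≁footprint : ∀ {i j} → j Fin.< i → ¬ InN (CyclePower n m) (vertex j) (footprint i)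
  earlier≁footprint {i} {j} j<i = far⇒¬InN (subst (m <_)
    (sym (cycDist-at (toℕ-inject≤ j K≤n) (toℕ-fromℕ< _) (≤-trans (<⇒≤ j<i) (m≤m+n _ _))))
    (⊓-glb m<d m<n∸d))
    where
    m<d : m < toℕ i + m ∸ toℕ j
    m<d = m+n≤o⇒m≤o∸n (suc m)
      (subst (λ k → suc k ≤ toℕ i + m) (+-comm (toℕ j) m) (+-monoˡ-≤ m j<i))
    m<n∸d : m < n ∸ (toℕ i + m ∸ toℕ j)
    m<n∸d = m<n∸o⇒o<n∸m (≤-<-trans (m∸n≤m (toℕ i + m) (toℕ j)) (i+m<n∸m i))

  sequence : List (Fin n)
  sequence = tabulate vertex

  dominates : Dominates (CyclePower n m) sequence
  dominates u with toℕ u <? m + K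
  ... | yes u<m+K = Any.tabulate⁺ _ (vertexAt-dominates (m<n+o⇒m∸n<o (toℕ u) m u<m+K)
                      (m∸n≤m (toℕ u) m) (inj₁ (m≤n+o⇒m∸n≤o (toℕ u) (toℕ u ∸ m) u≤u∸m+m)))
    where
    u≤u∸m+m : toℕ u ≤ toℕ u ∸ m + m
    u≤u∸m+m = subst (toℕ u ≤_) (+-comm m _) (m≤n+m∸n (toℕ u) m)
  ... | no u≮m+K = Any.tabulate⁺ _ (vertexAt-dominates (m<n⇒0<n∸m 2m<n)
                      z≤n (inj₂ (m≤n+o⇒m∸n≤o n (toℕ u) n≤u+m)))
    where
    n≤u+m : n ≤ toℕ u + m
    n≤u+m = begin
      n             ≡⟨ K+2m≡n ⟨
      K + (m + m)   ≡⟨ +-assoc K m m ⟨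
      K + m + m     ≤⟨ +-monoˡ-≤ m (subst (_≤ toℕ u) (+-comm m K) (≮⇒≥ u≮m+K)) ⟩
      toℕ u + m     ∎
      where open ≤-Reasoning

  legal : LegalDominating (CyclePower n m) sequence
  legal = Unique.tabulate⁺ (inject≤-injective _ _ _ _) , dominates
        , tabulate-footprinting (CyclePower n m) vertex footprint []
            vertex∼footprint earlier≁footprint (λ _ ())

grundyDomination : ∀ {n m} → m + m < n → GrundyDominationNumber (CyclePower n m) (n ∸ (m + m))
grundyDomination {n} {m} 2m<n = (sequence , legal , length-tabulate vertex) , λ _ → legal-length≤ 2m<n
  where open LowerBound {n} {m} 2m<n

-- The formula also holds for m = 0.
corollary1 : (m n : ℕ) → 1 ≤ m → 2 * (m + 1) ≤ n →
    GrundyDominationNumber (CyclePower n m) (n ∸ 2 * m)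
corollary1 m n _ 2[m+1]≤n =
  subst (λ k → GrundyDominationNumber (CyclePower n m) (n ∸ k)) (sym 2m≡m+m)
    (grundyDomination (subst (_< n) 2m≡m+m 2m<n))
  where
  2m≡m+m : 2 * m ≡ m + m
  2m≡m+m = cong (m +_) (+-identityʳ m)
  2m<n : 2 * m < n
  2m<n = <-≤-trans (*-monoʳ-< 2 (m<m+n m z<s)) 2[m+1]≤n
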